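{- Let $S$ be the set of rational numbers which have a continued fraction expansion of the form \[[0;4a_1,4a_2,\ldots,4a_n,a_{n+1},1,2],\] where $n\geq0$ and the $a_i$ are positive integers. Then every positive integer is admissible as a denominator of elements of $S$ (i.e. for every $m\geq1$ and every residue class modulo $m$, some element of $S$ has denominator in that class), yet no denominator of an element of $S$ is a perfect square.
   Context: Continued fractions: $[a_0;a_1,\ldots,a_n]=a_0+\cfrac{1}{a_1+\cfrac{1}{\ddots+\cfrac{1}{a_n}}}$. Denominators refer to rationals in lowest terms with positive denominator. -}

module Defs where

open import Data.Nat as ℕ using (ℕ; suc; _*_; _≤_)
open import Data.Integer as ℤ using ()
open import Data.Rational as ℚ using (ℚ; 0ℚ; 1/_; _+_; ≢-nonZero; ↧ₙ_)
open import Data.Rational.Properties using (_≟_)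
open import Data.List using (List; []; _∷_; _++_; map)
open import Data.Fin using (Fin)
open import Data.Vec.Functional using (toList)
open import Data.Product using (Σ; ∃; _×_)
open import Relation.Nullary using (yes; no)
open import Relation.Binary.PropositionalEquality using (_≡_)

-- reciprocal, with the (never used for positive tails) convention 1/0 := 0
inv : ℚ → ℚ
inv p with p ≟ 0ℚ
... | yes _ = 0ℚ
... | no p≢0 = 1/_ p {{≢-nonZero p≢0}}

cf : ℕ → List ℕ → ℚ
cf a [] = (ℤ.+ a ℚ./ 1)
cf a (b ∷ bs) = (ℤ.+ a ℚ./ 1) + inv (cf b bs)

tailS : (n : ℕ) → (Fin n → ℕ) → ℕ → List ℕ
tailS n a b = map (4 *_) (toList a) ++ (b ∷ 1 ∷ 2 ∷ [])

InS : ℚ → Set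
InS q = Σ ℕ λ n → Σ (Fin n → ℕ) λ a → Σ ℕ λ b →
          ((i : Fin n) → 1 ≤ a i) × (1 ≤ b) × (q ≡ cf 0 (tailS n a b))

den : ℚ → ℕ
den q = ↧ₙ q

-- For m = 2h + 1 coprime to v, Gauss's lemma gives the Jacobi symbol (v / m) as (-1) ^ μ(v, h), where
-- μ(v, h) counts the 1 ≤ i ≤ h with (v i mod m) > h.  Two properties of μ carry the argument:
-- μ(k², h) is even, because i ↦ |least absolute residue of k i| permutes 1, …, h; and the parity of
-- μ(y, h) does not change when m grows by 4y, by Eisenstein's count of lattice points under the line
-- j m = 2 y i.  The continuants (p, q) of [0; L] start at (3, 3b + 2) for L = b, 1, 2, where
-- ((3b + 2) / 3) = -1, and a new first partial quotient 4a sends (p, q) to (q, 4aq + p).  By the two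
-- properties the pair therefore keeps either (q / p) = -1 with p ≡ 3 (mod 4), or (p / q) = -1 with
-- q ≡ 3 (mod 4).  So the denominator q is never a square: squares have symbol +1, and are never 3 mod 4.
-- For admissibility, the denominators of [0; 4u, 4, b, 1, 2] reach every residue class modulo an odd M
-- by an explicit choice of u and b, and replacing b by b + M changes the denominator by an odd multiple
-- of M, which lifts a solution modulo M to one modulo 2M.
module Submission where

open import Defs
open import Data.Nat.Base
  using (ℕ; zero; suc; _+_; _*_; _∸_; _≤_; _<_; z≤n; s≤s; s≤s⁻¹; NonZero; >-nonZero; >-nonZero⁻¹;
         _%_; _/_; parity)
open import Data.Nat.Properties
open import Data.Nat.DivMod
open import Data.Nat.Divisibility
open import Data.Nat.Coprimality as Coprimality using (Coprime; coprime?; coprime-divisor)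
open import Data.Nat.Induction using (<-rec)
open import Data.Nat.Tactic.RingSolver using (solve-∀)
open import Data.Parity.Base using (0ℙ; 1ℙ) renaming (_+_ to _ℙ+_)
import Data.Parity.Properties as ℙ
open import Data.Integer.Base as ℤ using ()
import Data.Integer.Properties as ℤ
open import Data.Rational.Base as ℚ using (ℚ; mkℚ; mkℚ+; 0ℚ; ↥_)
open import Data.Rational.Properties using (normalize-coprime; /-cong)
  renaming (_≟_ to _≟ℚ_; +-identityˡ to ℚ-+-identityˡ; +-identityʳ to ℚ-+-identityʳ)
open import Data.Fin.Base using (Fin; zero; suc; toℕ; fromℕ<; punchOut)
open import Data.Fin.Properties
  using (toℕ<n; toℕ-fromℕ<; toℕ-injective; punchOut-injective; injective⇒≤; any?)
  renaming (_≟_ to _≟ᶠ_)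
open import Data.Fin.Permutation using (Permutation′; permutation)
open import Data.Vec.Functional using (toList)
open import Data.List.Base using (List; []; _∷_; _++_; map)
open import Data.List.Relation.Unary.All using (All; []; _∷_)
open import Data.Product.Base using (Σ; ∃; ∃₂; _×_; _,_; proj₁; proj₂)
open import Data.Sum.Base using (_⊎_; inj₁; inj₂)
open import Function.Base using (_∘_)
open import Function.Definitions using (Injective)
open import Relation.Nullary using (Dec; yes; no; ¬_; contradiction)
open import Relation.Nullary.Decidable using (from-yes)
open import Relation.Binary.PropositionalEquality
open import Algebra.Properties.CommutativeMonoid.Sum +-0-commutativeMonoid
  using (sum; sum-cong-≗; ∑-permute; ∑-distrib-+; ∑-comm)

-- Sums over 1, …, n

injective⇒surjective : ∀ {n} {f : Fin n → Fin n} → Injective _≡_ _≡_ f →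
                       ∀ y → ∃ λ x → f x ≡ y
injective⇒surjective {suc n} {f} f-injective y with any? (λ x → f x ≟ᶠ y)
... | yes hit = hit
... | no miss = contradiction (injective⇒≤ skip-y-injective) 1+n≰n
  where
  y≢f : ∀ x → y ≢ f x
  y≢f x y≡fx = miss (x , sym y≡fx)
  skip-y : Fin (suc n) → Fin n
  skip-y x = punchOut (y≢f x)
  skip-y-injective : Injective _≡_ _≡_ skip-y
  skip-y-injective {x} {x′} eq = f-injective (punchOut-injective (y≢f x) (y≢f x′) eq)

injective⇒permutation : ∀ {n} {f : Fin n → Fin n} → Injective _≡_ _≡_ f → Permutation′ n
injective⇒permutation {f = f} f-injective =
  permutation f (proj₁ ∘ onto) (proj₂ ∘ onto) (λ x → f-injective (proj₂ (onto (f x))))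
  where onto = injective⇒surjective f-injective

-- ∑ n f = f 1 + ⋯ + f n
∑ : ℕ → (ℕ → ℕ) → ℕ
∑ n f = sum {n} (λ i → f (suc (toℕ i)))

∑-cong : ∀ n (f g : ℕ → ℕ) → (∀ i → 1 ≤ i → i ≤ n → f i ≡ g i) → ∑ n f ≡ ∑ n g
∑-cong n f g f≡g = sum-cong-≗ (λ i → f≡g (suc (toℕ i)) (s≤s z≤n) (toℕ<n i))

∑-+ : ∀ n f g → ∑ n (λ i → f i + g i) ≡ ∑ n f + ∑ n g
∑-+ n f g = ∑-distrib-+ {n} (λ i → f (suc (toℕ i))) (λ i → g (suc (toℕ i)))

∑-swap : ∀ m n (f : ℕ → ℕ → ℕ) →
         ∑ m (λ i → ∑ n (f i)) ≡ ∑ n (λ j → ∑ m (λ i → f i j))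
∑-swap m n f = ∑-comm {m} {n} (λ i j → f (suc (toℕ i)) (suc (toℕ j)))

∑-const : ∀ n c → ∑ n (λ _ → c) ≡ n * c
∑-const zero    c = refl
∑-const (suc n) c = cong (c +_) (∑-const n c)

∑-++ : ∀ m n f → ∑ (m + n) f ≡ ∑ m f + ∑ n (λ i → f (m + i))
∑-++ zero    n f = refl
∑-++ (suc m) n f = trans (cong (f 1 +_) (∑-++ m n (f ∘ suc))) (sym (+-assoc (f 1) _ _))

parity-∑-cong : ∀ n (f g : ℕ → ℕ) → (∀ i → 1 ≤ i → i ≤ n → parity (f i) ≡ parity (g i)) →
                parity (∑ n f) ≡ parity (∑ n g)
parity-∑-cong zero    f g _  = refl
parity-∑-cong (suc n) f g eq = begin
  parity (f 1 + ∑ n (f ∘ suc))              ≡⟨ ℙ.+-homo-+ (f 1) _ ⟩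
  parity (f 1) ℙ+ parity (∑ n (f ∘ suc))    ≡⟨ cong₂ _ℙ+_ (eq 1 (s≤s z≤n) (s≤s z≤n)) rest ⟩
  parity (g 1) ℙ+ parity (∑ n (g ∘ suc))    ≡⟨ ℙ.+-homo-+ (g 1) _ ⟨
  parity (g 1 + ∑ n (g ∘ suc))              ∎
  where
  open ≡-Reasoning
  rest : parity (∑ n (f ∘ suc)) ≡ parity (∑ n (g ∘ suc))
  rest = parity-∑-cong n (f ∘ suc) (g ∘ suc) (λ i _ i≤n → eq (suc i) (s≤s z≤n) (s≤s i≤n))

module _ {n} (σ : ℕ → ℕ)
         (σ-range : ∀ i → 1 ≤ i → i ≤ n → 1 ≤ σ i × σ i ≤ n)
         (σ-injective : ∀ i j → 1 ≤ i → i ≤ n → 1 ≤ j → j ≤ n → σ i ≡ σ j → i ≡ j)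
  where

  private
    σ-range′ : ∀ (i : Fin n) → 1 ≤ σ (suc (toℕ i)) × σ (suc (toℕ i)) ≤ n
    σ-range′ i = σ-range (suc (toℕ i)) (s≤s z≤n) (toℕ<n i)

    σᶠ : Fin n → Fin n
    σᶠ i with σ (suc (toℕ i)) | σ-range′ i
    ... | suc j | _ , j<n = fromℕ< j<n

    suc-toℕ-σᶠ : ∀ i → suc (toℕ (σᶠ i)) ≡ σ (suc (toℕ i))
    suc-toℕ-σᶠ i with σ (suc (toℕ i)) | σ-range′ i
    ... | suc j | _ , j<n = cong suc (toℕ-fromℕ< j<n)

    σᶠ-injective : Injective _≡_ _≡_ σᶠ
    σᶠ-injective {i} {j} σᶠi≡σᶠj = toℕ-injective (suc-injective
      (σ-injective _ _ (s≤s z≤n) (toℕ<n i) (s≤s z≤n) (toℕ<n j)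
        (trans (sym (suc-toℕ-σᶠ i)) (trans (cong (suc ∘ toℕ) σᶠi≡σᶠj) (suc-toℕ-σᶠ j)))))

  ∑-reindex : ∀ f → ∑ n (f ∘ σ) ≡ ∑ n f
  ∑-reindex f = sym (trans (∑-permute (λ i → f (suc (toℕ i))) (injective⇒permutation σᶠ-injective))
                           (sum-cong-≗ (λ i → cong f (suc-toℕ-σᶠ i))))

𝟙[_] : ∀ {p} {P : Set p} → Dec P → ℕ
𝟙[ yes _ ] = 1
𝟙[ no _ ]  = 0

𝟙-yes : ∀ {p} {P : Set p} (P? : Dec P) → P → 𝟙[ P? ] ≡ 1
𝟙-yes (yes _) _  = refl
𝟙-yes (no ¬p) p = contradiction p ¬p

𝟙-no : ∀ {p} {P : Set p} (P? : Dec P) → ¬ P → 𝟙[ P? ] ≡ 0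
𝟙-no (yes p) ¬p = contradiction p ¬p
𝟙-no (no _)  _  = refl

𝟙-cong : ∀ {p q} {P : Set p} {Q : Set q} → (P → Q) → (Q → P) → (P? : Dec P) (Q? : Dec Q) →
         𝟙[ P? ] ≡ 𝟙[ Q? ]
𝟙-cong P→Q Q→P (yes p) Q? = sym (𝟙-yes Q? (P→Q p))
𝟙-cong P→Q Q→P (no ¬p) Q? = sym (𝟙-no Q? (¬p ∘ Q→P))

parity-double : ∀ n → parity (n + n) ≡ 0ℙ
parity-double n = trans (ℙ.+-homo-+ n n) (ℙ.p+p≡0ℙ (parity n))

%≡⇒∣ : ∀ a d m .{{_ : NonZero m}} → a % m ≡ (a + d) % m → m ∣ d
%≡⇒∣ a d m eq = ∣m+n∣m⇒∣n (divides ((a + d) / m) quotients) (n∣m*n (a / m))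
  where
  quotients : a / m * m + d ≡ (a + d) / m * m
  quotients = +-cancelˡ-≡ (a % m) _ _ (begin
    a % m + (a / m * m + d)         ≡⟨ +-assoc (a % m) _ d ⟨
    a % m + a / m * m + d           ≡⟨ cong (_+ d) (m≡m%n+[m/n]*n a m) ⟨
    a + d                           ≡⟨ m≡m%n+[m/n]*n (a + d) m ⟩
    (a + d) % m + (a + d) / m * m   ≡⟨ cong (_+ (a + d) / m * m) eq ⟨
    a % m + (a + d) / m * m         ∎)
    where open ≡-Reasoning

∣∧<⇒≡0 : ∀ {m d} → m ∣ d → d < m → d ≡ 0
∣∧<⇒≡0 {d = zero}  _   _   = refl
∣∧<⇒≡0 {d = suc _} m∣d d<m = contradiction m∣d (>⇒∤ d<m)

∣a+b⇒b≡m∸a : ∀ {a b m} → 0 < a → a < m → b < m → m ∣ a + b → b ≡ m ∸ a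
∣a+b⇒b≡m∸a {a} {b} {m} 0<a a<m b<m (divides q a+b≡q*m) with q
... | 0            = contradiction (sym a+b≡q*m) (<⇒≢ (<-≤-trans 0<a (m≤m+n a b)))
... | 1            = sym (trans (cong (_∸ a) (sym (trans a+b≡q*m (*-identityˡ m)))) (m+n∸m≡n a b))
... | suc (suc q′) = contradiction a+b≡q*m
                       (<⇒≢ (<-≤-trans (+-mono-< a<m b<m) (+-monoʳ-≤ m (m≤m+n m (q′ * m)))))

2*_+1 : ℕ → ℕ
2* h +1 = suc (h + h)

gaussNeg : ℕ → ℕ → ℕ → ℕ
gaussNeg v h i = 𝟙[ h <? (v * i) % 2* h +1 ]

-- By Gauss's lemma, (-1) ^ gaussCount v h is the Jacobi symbol (v / 2h+1) when v is coprime to 2h+1.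
gaussCount : ℕ → ℕ → ℕ
gaussCount v h = ∑ h (gaussNeg v h)

complement-parity : ∀ h s → parity 𝟙[ h <? 2* h +1 ∸ s ] ≡ parity (1 + 𝟙[ h <? s ])
complement-parity h s with h <? s | h <? 2* h +1 ∸ s
... | yes h<s | yes h<m∸s = contradiction
  (subst (2* h +1 ∸ s ≤_) (m+n∸m≡n (suc h) h) (∸-monoʳ-≤ (2* h +1) h<s)) (<⇒≱ h<m∸s)
... | yes _   | no _      = refl
... | no _    | yes _     = refl
... | no h≮s  | no h≮m∸s = contradiction
  (subst (_≤ 2* h +1 ∸ s) (m+n∸n≡m (suc h) h) (∸-monoʳ-≤ (2* h +1) (≮⇒≥ h≮s))) h≮m∸s

-- Gauss counts of squares

module _ (k h : ℕ) (k⊥m : Coprime k (2* h +1)) where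

  private
    m : ℕ
    m = 2* h +1

    r : ℕ → ℕ
    r i = (k * i) % m

    h<m : h < m
    h<m = s≤s (m≤m+n h h)

    r<m : ∀ i → r i < m
    r<m i = m%n<n (k * i) m

    m∣k*⇒m∣ : ∀ {d} → m ∣ k * d → m ∣ d
    m∣k*⇒m∣ = coprime-divisor (Coprimality.sym k⊥m)

    r≡0⇒m∣ : ∀ {d} → r d ≡ 0 → m ∣ d
    r≡0⇒m∣ {d} r≡0 = m∣k*⇒m∣ (m%n≡0⇒n∣m (k * d) m r≡0)

    r-nonzero : ∀ i → 1 ≤ i → i ≤ h → r i ≢ 0
    r-nonzero i 1≤i i≤h r≡0 = <⇒≢ 1≤i (sym (∣∧<⇒≡0 (r≡0⇒m∣ r≡0) (≤-<-trans i≤h h<m)))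

    r-injective-≤ : ∀ {i j} → i ≤ j → j ≤ h → r i ≡ r j → i ≡ j
    r-injective-≤ {i} i≤j j≤h ri≡rj with m≤n⇒∃[o]m+o≡n i≤j
    ... | d , refl = sym (trans (cong (i +_) d≡0) (+-identityʳ i))
      where
      m∣d : m ∣ d
      m∣d = m∣k*⇒m∣ (%≡⇒∣ (k * i) (k * d) m (trans ri≡rj (cong (_% m) (*-distribˡ-+ k i d))))
      d≡0 : d ≡ 0
      d≡0 = ∣∧<⇒≡0 m∣d (≤-<-trans (≤-trans (m≤n+m d i) j≤h) h<m)

    r-injective : ∀ i j → i ≤ h → j ≤ h → r i ≡ r j → i ≡ j
    r-injective i j i≤h j≤h ri≡rj with ≤-total i j
    ... | inj₁ i≤j = r-injective-≤ i≤j j≤h ri≡rj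
    ... | inj₂ j≤i = sym (r-injective-≤ j≤i i≤h (sym ri≡rj))

    r+r≢m : ∀ i j → 1 ≤ i → i ≤ h → j ≤ h → r i + r j ≢ m
    r+r≢m i j 1≤i i≤h j≤h ri+rj≡m =
      <⇒≢ (≤-trans 1≤i (m≤m+n i j)) (sym (∣∧<⇒≡0 (r≡0⇒m∣ r[i+j]≡0) i+j<m))
      where
      i+j<m : i + j < m
      i+j<m = s≤s (+-mono-≤ i≤h j≤h)
      r[i+j]≡0 : r (i + j) ≡ 0
      r[i+j]≡0 = begin
        (k * (i + j)) % m      ≡⟨ cong (_% m) (*-distribˡ-+ k i j) ⟩
        (k * i + k * j) % m    ≡⟨ %-distribˡ-+ (k * i) (k * j) m ⟩
        (r i + r j) % m        ≡⟨ cong (_% m) ri+rj≡m ⟩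
        m % m                  ≡⟨ n%n≡0 m ⟩
        0                      ∎
        where open ≡-Reasoning

    r-square : ∀ i → (k * k * i) % m ≡ r (r i)
    r-square i = begin
      (k * k * i) % m           ≡⟨ cong (_% m) (*-assoc k k i) ⟩
      (k * (k * i)) % m         ≡⟨ %-distribˡ-* k (k * i) m ⟩
      (k % m * r i) % m         ≡⟨ cong (λ x → (k % m * x) % m) (m%n%n≡m%n (k * i) m) ⟨
      (k % m * (r i % m)) % m   ≡⟨ %-distribˡ-* k (r i) m ⟨
      r (r i)                   ∎
      where open ≡-Reasoning

    m∸r-range : ∀ i → h < r i → 1 ≤ m ∸ r i × m ∸ r i ≤ h
    m∸r-range i h<r = m<n⇒0<n∸m (r<m i) , subst (m ∸ r i ≤_) (m+n∸m≡n (suc h) h) (∸-monoʳ-≤ m h<r)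

    r-complement : ∀ i → h < r i → r (r i) ≡ m ∸ r (m ∸ r i)
    r-complement i h<r = ∣a+b⇒b≡m∸a 0<a (r<m (m ∸ r i)) (r<m (r i)) (m%n≡0⇒n∣m _ m a+b≡0)
      where
      0<a : 0 < r (m ∸ r i)
      0<a = n≢0⇒n>0 (r-nonzero (m ∸ r i) (proj₁ (m∸r-range i h<r)) (proj₂ (m∸r-range i h<r)))
      a+b≡0 : (r (m ∸ r i) + r (r i)) % m ≡ 0
      a+b≡0 = begin
        (r (m ∸ r i) + r (r i)) % m     ≡⟨ %-distribˡ-+ (k * (m ∸ r i)) (k * r i) m ⟨
        (k * (m ∸ r i) + k * r i) % m   ≡⟨ cong (_% m) (*-distribˡ-+ k (m ∸ r i) (r i)) ⟨
        (k * (m ∸ r i + r i)) % m       ≡⟨ cong (λ x → (k * x) % m) (m∸n+n≡m (<⇒≤ (r<m i))) ⟩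
        (k * m) % m                     ≡⟨ m*n%n≡0 k m ⟩
        0                               ∎
        where open ≡-Reasoning

    ρ : ℕ → ℕ
    ρ i with h <? r i
    ... | yes _ = m ∸ r i
    ... | no _  = r i

    ρ-range : ∀ i → 1 ≤ i → i ≤ h → 1 ≤ ρ i × ρ i ≤ h
    ρ-range i 1≤i i≤h with h <? r i
    ... | yes h<r = m∸r-range i h<r
    ... | no h≮r  = n≢0⇒n>0 (r-nonzero i 1≤i i≤h) , ≮⇒≥ h≮r

    ρ-injective : ∀ i j → 1 ≤ i → i ≤ h → 1 ≤ j → j ≤ h → ρ i ≡ ρ j → i ≡ j
    ρ-injective i j 1≤i i≤h 1≤j j≤h ρi≡ρj with h <? r i | h <? r j
    ... | yes _ | yes _ = r-injective i j i≤h j≤h (∸-cancelˡ-≡ (<⇒≤ (r<m i)) (<⇒≤ (r<m j)) ρi≡ρj)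
    ... | no _  | no _  = r-injective i j i≤h j≤h ρi≡ρj
    ... | yes _ | no _  = contradiction (trans (cong (r i +_) (sym ρi≡ρj)) (m+[n∸m]≡n (<⇒≤ (r<m i))))
                                        (r+r≢m i j 1≤i i≤h j≤h)
    ... | no _  | yes _ = contradiction (trans (cong (r j +_) ρi≡ρj) (m+[n∸m]≡n (<⇒≤ (r<m j))))
                                        (r+r≢m j i 1≤j j≤h i≤h)

    -- k² i ≡ ± k ρ(i) with the sign of k i's least absolute residue, so k² i lands in the upper half
    -- exactly when one of k i and k ρ(i) does.
    gaussNeg-square : ∀ i → 1 ≤ i → i ≤ h →
                      parity (gaussNeg (k * k) h i) ≡ parity (gaussNeg k h i + gaussNeg k h (ρ i))
    gaussNeg-square i 1≤i i≤h with h <? r i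
    ... | no _    = cong (λ s → parity 𝟙[ h <? s ]) (r-square i)
    ... | yes h<r = trans (cong (λ s → parity 𝟙[ h <? s ]) (trans (r-square i) (r-complement i h<r)))
                          (complement-parity h (r (m ∸ r i)))

  gaussCount-square : parity (gaussCount (k * k) h) ≡ 0ℙ
  gaussCount-square = begin
    parity (gaussCount (k * k) h)
      ≡⟨ parity-∑-cong h (gaussNeg (k * k) h) μ+μ∘ρ gaussNeg-square ⟩
    parity (∑ h μ+μ∘ρ)
      ≡⟨ cong parity (∑-+ h μ (μ ∘ ρ)) ⟩
    parity (gaussCount k h + ∑ h (μ ∘ ρ))
      ≡⟨ cong (λ n → parity (gaussCount k h + n)) (∑-reindex ρ ρ-range ρ-injective μ) ⟩
    parity (gaussCount k h + gaussCount k h)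
      ≡⟨ parity-double (gaussCount k h) ⟩
    0ℙ ∎
    where
    open ≡-Reasoning
    μ μ+μ∘ρ : ℕ → ℕ
    μ = gaussNeg k h
    μ+μ∘ρ i = μ i + μ (ρ i)

-- Periodicity in the modulus

m<[1+m/n]*n : ∀ m n .{{_ : NonZero n}} → m < suc (m / n) * n
m<[1+m/n]*n m n = begin-strict
  m                   ≡⟨ m≡m%n+[m/n]*n m n ⟩
  m % n + m / n * n   <⟨ +-monoˡ-< (m / n * n) (m%n<n m n) ⟩
  n + m / n * n       ∎
  where open ≤-Reasoning

count-multiples : ∀ x .{{_ : NonZero x}} v J → v / x ≤ J → ∑ J (λ j → 𝟙[ j * x ≤? v ]) ≡ v / x
count-multiples x v J v/x≤J with m≤n⇒∃[o]m+o≡n v/x≤J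
... | e , refl = begin
  ∑ (t + e) multiple                           ≡⟨ ∑-++ t e multiple ⟩
  ∑ t multiple + ∑ e (λ i → multiple (t + i))  ≡⟨ cong₂ _+_ (∑-cong t _ _ below) (∑-cong e _ _ above) ⟩
  ∑ t (λ _ → 1) + ∑ e (λ _ → 0)                ≡⟨ cong₂ _+_ (∑-const t 1) (∑-const e 0) ⟩
  t * 1 + e * 0                                ≡⟨ cong₂ _+_ (*-identityʳ t) (*-zeroʳ e) ⟩
  t + 0                                        ≡⟨ +-identityʳ t ⟩
  t                                            ∎
  where
  open ≡-Reasoning
  t = v / x
  multiple : ℕ → ℕ
  multiple j = 𝟙[ j * x ≤? v ]
  below : ∀ j → 1 ≤ j → j ≤ t → multiple j ≡ 1
  below j _ j≤t = 𝟙-yes (j * x ≤? v) (≤-trans (*-monoˡ-≤ x j≤t) (m/n*n≤m v x))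
  above : ∀ i → 1 ≤ i → i ≤ e → multiple (t + i) ≡ 0
  above i 1≤i _ = 𝟙-no ((t + i) * x ≤? v) (<⇒≱ (<-≤-trans (m<[1+m/n]*n v x) (*-monoˡ-≤ x 1+t≤t+i)))
    where
    1+t≤t+i : suc t ≤ t + i
    1+t≤t+i = m<m+n t 1≤i

[r+r]/m≡𝟙[h<r] : ∀ h r → r < 2* h +1 → (r + r) / 2* h +1 ≡ 𝟙[ h <? r ]
[r+r]/m≡𝟙[h<r] h r r<m with h <? r
... | no h≮r  = m<n⇒m/n≡0 (s≤s (+-mono-≤ (≮⇒≥ h≮r) (≮⇒≥ h≮r)))
... | yes h<r = begin
  (r + r) / m            ≡⟨ m/n≡1+[m∸n]/n m≤r+r ⟩
  1 + (r + r ∸ m) / m    ≡⟨ cong suc (m<n⇒m/n≡0 r+r∸m<m) ⟩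
  1                      ∎
  where
  open ≡-Reasoning
  m = 2* h +1
  m≤r+r : m ≤ r + r
  m≤r+r = ≤-trans (n≤1+n m) (subst (_≤ r + r) (cong suc (+-suc h h)) (+-mono-≤ h<r h<r))
  r+r∸m<m : r + r ∸ m < m
  r+r∸m<m = subst (r + r ∸ m <_) (m+n∸n≡m m m) (∸-monoˡ-< (+-mono-< r<m r<m) m≤r+r)

parity-[w+w]/m : ∀ h w → parity ((w + w) / 2* h +1) ≡ parity 𝟙[ h <? w % 2* h +1 ]
parity-[w+w]/m h w = begin
  parity ((w + w) / m)                        ≡⟨ cong (λ n → parity (n / m)) w+w≡ ⟩
  parity ((r + r + (q + q) * m) / m)          ≡⟨ cong parity (+-distrib-/-∣ʳ (r + r) (n∣m*n (q + q))) ⟩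
  parity ((r + r) / m + (q + q) * m / m)      ≡⟨ cong (λ n → parity ((r + r) / m + n)) (m*n/n≡m (q + q) m) ⟩
  parity ((r + r) / m + (q + q))              ≡⟨ ℙ.+-homo-+ ((r + r) / m) (q + q) ⟩
  parity ((r + r) / m) ℙ+ parity (q + q)      ≡⟨ cong₂ _ℙ+_ (cong parity [r+r]/m≡) (parity-double q) ⟩
  parity 𝟙[ h <? r ] ℙ+ 0ℙ                    ≡⟨ ℙ.+-identityʳ _ ⟩
  parity 𝟙[ h <? r ]                          ∎
  where
  open ≡-Reasoning
  m = 2* h +1
  r = w % m
  q = w / m
  double-split : ∀ r q m → (r + q * m) + (r + q * m) ≡ r + r + (q + q) * m
  double-split = solve-∀
  w+w≡ : w + w ≡ r + r + (q + q) * m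
  w+w≡ = trans (cong (λ n → n + n) (m≡m%n+[m/n]*n w m)) (double-split r q m)
  [r+r]/m≡ : (r + r) / m ≡ 𝟙[ h <? r ]
  [r+r]/m≡ = [r+r]/m≡𝟙[h<r] h r (m%n<n w m)

lattice : ℕ → ℕ → ℕ → ℕ
lattice y h j = ∑ h (λ i → 𝟙[ j * 2* h +1 ≤? y * i + y * i ])

-- ⌊2 y i / m⌋ counts the j < y with j m ≤ 2 y i, and its parity is that of gaussNeg y h i.
gaussCount-lattice-parity : ∀ y′ h →
                            parity (gaussCount (suc y′) h) ≡ parity (∑ y′ (lattice (suc y′) h))
gaussCount-lattice-parity y′ h = let open ≡-Reasoning in begin
  parity (gaussCount y h)               ≡⟨ parity-∑-cong h (gaussNeg y h) (∑ y′ ∘ below) column ⟩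
  parity (∑ h (∑ y′ ∘ below))           ≡⟨ cong parity (∑-swap h y′ below) ⟩
  parity (∑ y′ (lattice y h))           ∎
  where
  y = suc y′
  m = 2* h +1
  below : ℕ → ℕ → ℕ
  below i j = 𝟙[ j * m ≤? y * i + y * i ]
  column : ∀ i → 1 ≤ i → i ≤ h → parity (gaussNeg y h i) ≡ parity (∑ y′ (below i))
  column i _ i≤h = sym (trans (cong parity (count-multiples m (y * i + y * i) y′ [2yi]/m≤y′))
                              (parity-[w+w]/m h (y * i)))
    where
    [2yi]/m≤y′ : (y * i + y * i) / m ≤ y′
    [2yi]/m≤y′ = s≤s⁻¹ (m<n*o⇒m/o<n (begin-strict
      y * i + y * i  ≡⟨ *-distribˡ-+ y i i ⟨
      y * (i + i)    ≤⟨ *-monoʳ-≤ y (+-mono-≤ i≤h i≤h) ⟩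
      y * (h + h)    <⟨ *-monoʳ-< y (n<1+n (h + h)) ⟩
      y * m          ∎))
      where open ≤-Reasoning

-- Row j for h + 2y: its first 2j columns are empty, the next h reproduce row j for h,
-- and the last 2 (y - j) are full.
lattice-shift : ∀ h j e → 1 ≤ j → let y = suc (j + e) in
                lattice y (h + (y + y)) j ≡ lattice y h j + (suc e + suc e)
lattice-shift h j e 1≤j = let open ≡-Reasoning in begin
  ∑ h′ f
    ≡⟨ cong (λ n → ∑ n f) (h′≡ h j e) ⟩
  ∑ (j + j + B) f
    ≡⟨ ∑-++ (j + j) B f ⟩
  ∑ (j + j) f + ∑ B (λ i → f (j + j + i))
    ≡⟨ cong₂ _+_ (∑-cong (j + j) f (λ _ → 0) empty) (∑-cong B _ g shifted) ⟩
  ∑ (j + j) (λ _ → 0) + ∑ B g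
    ≡⟨ cong (_+ ∑ B g) (trans (∑-const (j + j) 0) (*-zeroʳ (j + j))) ⟩
  ∑ B g
    ≡⟨ ∑-++ h (suc e + suc e) g ⟩
  lattice y h j + ∑ (suc e + suc e) (λ i → g (h + i))
    ≡⟨ cong (lattice y h j +_) (∑-cong (suc e + suc e) _ (λ _ → 1) full) ⟩
  lattice y h j + ∑ (suc e + suc e) (λ _ → 1)
    ≡⟨ cong (lattice y h j +_) (trans (∑-const (suc e + suc e) 1) (*-identityʳ _)) ⟩
  lattice y h j + (suc e + suc e)
    ∎
  where
  y = suc (j + e)
  h′ = h + (y + y)
  B = h + (suc e + suc e)
  D = y * (j + j) + y * (j + j)
  f g : ℕ → ℕ
  f i = 𝟙[ j * 2* h′ +1 ≤? y * i + y * i ]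
  g i = 𝟙[ j * 2* h +1 ≤? y * i + y * i ]

  h′≡ : ∀ h j e → h + (suc (j + e) + suc (j + e)) ≡ j + j + (h + (suc e + suc e))
  h′≡ = solve-∀
  j*m′≡ : ∀ h j y → j * suc (h + (y + y) + (h + (y + y))) ≡ (y * (j + j) + y * (j + j)) + j * suc (h + h)
  j*m′≡ = solve-∀
  2y[2j+i]≡ : ∀ y j i → y * (j + j + i) + y * (j + j + i) ≡ (y * (j + j) + y * (j + j)) + (y * i + y * i)
  2y[2j+i]≡ = solve-∀

  empty : ∀ i → 1 ≤ i → i ≤ j + j → f i ≡ 0
  empty i _ i≤2j = 𝟙-no (j * 2* h′ +1 ≤? y * i + y * i) (<⇒≱ (begin-strict
    y * i + y * i      ≤⟨ +-mono-≤ (*-monoʳ-≤ y i≤2j) (*-monoʳ-≤ y i≤2j) ⟩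
    D                  <⟨ m<m+n D (*-mono-≤ 1≤j (s≤s z≤n)) ⟩
    D + j * 2* h +1    ≡⟨ j*m′≡ h j y ⟨
    j * 2* h′ +1       ∎))
    where open ≤-Reasoning

  shifted : ∀ i → 1 ≤ i → i ≤ B → f (j + j + i) ≡ g i
  shifted i _ _ = trans (cong₂ (λ a b → 𝟙[ a ≤? b ]) (j*m′≡ h j y) (2y[2j+i]≡ y j i))
                        (𝟙-cong (+-cancelˡ-≤ D _ _) (+-monoʳ-≤ D) (_ ≤? _) (_ ≤? _))

  full : ∀ i → 1 ≤ i → i ≤ suc e + suc e → g (h + i) ≡ 1
  full i 1≤i _ = 𝟙-yes (j * 2* h +1 ≤? y * (h + i) + y * (h + i)) (begin
    j * 2* h +1                ≤⟨ *-monoˡ-≤ (2* h +1) (m≤n⇒m≤1+n (m≤m+n j e)) ⟩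
    y * 2* h +1                ≤⟨ *-monoʳ-≤ y (+-mono-≤ (m<m+n h 1≤i) (m≤m+n h i)) ⟩
    y * ((h + i) + (h + i))    ≡⟨ *-distribˡ-+ y (h + i) (h + i) ⟩
    y * (h + i) + y * (h + i)  ∎)
    where open ≤-Reasoning

gaussCount-periodic : ∀ y h → parity (gaussCount y (h + (y + y))) ≡ parity (gaussCount y h)
gaussCount-periodic zero     h = cong (λ n → parity (∑ n (gaussNeg 0 n))) (+-identityʳ h)
gaussCount-periodic (suc y′) h = begin
  parity (gaussCount y (h + (y + y)))        ≡⟨ gaussCount-lattice-parity y′ (h + (y + y)) ⟩
  parity (∑ y′ (lattice y (h + (y + y))))    ≡⟨ parity-∑-cong y′ (lattice y (h + (y + y))) (lattice y h)
                                                                 row-parity ⟩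
  parity (∑ y′ (lattice y h))                ≡⟨ gaussCount-lattice-parity y′ h ⟨
  parity (gaussCount y h)                    ∎
  where
  open ≡-Reasoning
  y = suc y′
  row-parity : ∀ j → 1 ≤ j → j ≤ y′ → parity (lattice y (h + (y + y)) j) ≡ parity (lattice y h j)
  row-parity j 1≤j j≤y′ with m≤n⇒∃[o]m+o≡n j≤y′
  ... | e , refl = begin
    parity (lattice y (h + (y + y)) j)                 ≡⟨ cong parity (lattice-shift h j e 1≤j) ⟩
    parity (lattice y h j + (suc e + suc e))           ≡⟨ ℙ.+-homo-+ (lattice y h j) _ ⟩
    parity (lattice y h j) ℙ+ parity (suc e + suc e)   ≡⟨ cong (parity (lattice y h j) ℙ+_) 2e+2-even ⟩
    parity (lattice y h j) ℙ+ 0ℙ                       ≡⟨ ℙ.+-identityʳ _ ⟩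
    parity (lattice y h j)                             ∎
    where
    2e+2-even : parity (suc e + suc e) ≡ 0ℙ
    2e+2-even = parity-double (suc e)

gaussCount-periodic-* : ∀ c y h → parity (gaussCount y (h + c * (y + y))) ≡ parity (gaussCount y h)
gaussCount-periodic-* zero    y h = cong (λ n → parity (gaussCount y n)) (+-identityʳ h)
gaussCount-periodic-* (suc c) y h = begin
  parity (gaussCount y (h + suc c * (y + y)))        ≡⟨ cong (λ n → parity (gaussCount y n))
                                                             (regroup h (y + y) (c * (y + y))) ⟩
  parity (gaussCount y (h + c * (y + y) + (y + y)))  ≡⟨ gaussCount-periodic y (h + c * (y + y)) ⟩
  parity (gaussCount y (h + c * (y + y)))            ≡⟨ gaussCount-periodic-* c y h ⟩
  parity (gaussCount y h)                            ∎
  where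
  open ≡-Reasoning
  regroup : ∀ a b c → a + (b + c) ≡ a + c + b
  regroup = solve-∀

-- Continuants

-- [0; L] = cfNum L / cfDen L
cfNum cfDen : List ℕ → ℕ
cfNum []      = 0
cfNum (a ∷ L) = cfDen L
cfDen []      = 1
cfDen (a ∷ L) = a * cfDen L + cfNum L

coprime-*-+ : ∀ a {p q} → Coprime p q → Coprime q (a * q + p)
coprime-*-+ a p⊥q (d∣q , d∣aq+p) = p⊥q (∣m+n∣m⇒∣n d∣aq+p (∣n⇒∣m*n a d∣q) , d∣q)

cfNum-cfDen-coprime : ∀ L → Coprime (cfNum L) (cfDen L)
cfNum-cfDen-coprime []      (_ , d∣1) = ∣1⇒≡1 d∣1
cfNum-cfDen-coprime (a ∷ L) = coprime-*-+ a (cfNum-cfDen-coprime L)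

cfDen-nonZero : ∀ {L} → All (1 ≤_) L → NonZero (cfDen L)
cfDen-nonZero pos = >-nonZero (positive pos)
  where
  positive : ∀ {L} → All (1 ≤_) L → 1 ≤ cfDen L
  positive []                   = s≤s z≤n
  positive {a ∷ L} (1≤a ∷ pos) =
    ≤-trans (*-mono-≤ 1≤a (positive pos)) (m≤m+n (a * cfDen L) (cfNum L))

inv-mkℚ+ : ∀ n d .{{_ : NonZero n}} .{{_ : NonZero d}} .(c : Coprime n d) →
           inv (mkℚ+ n d c) ≡ mkℚ+ d n (Coprimality.sym c)
inv-mkℚ+ (suc n) (suc d) c with mkℚ (ℤ.+ suc n) d c ≟ℚ 0ℚ
... | yes p≡0 = contradiction (cong ↥_ p≡0) λ ()
... | no _    = refl

+-mkℚ+ : ∀ a p q .{{_ : NonZero q}} .(c : Coprime p q) →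
         (ℤ.+ a ℚ./ 1) ℚ.+ mkℚ+ p q c ≡ mkℚ+ (a * q + p) q (Coprimality.sym (coprime-*-+ a c))
+-mkℚ+ a p (suc n) c = begin
  (ℤ.+ a ℚ./ 1) ℚ.+ mkℚ (ℤ.+ p) n c        ≡⟨ cong (ℚ._+ _) (normalize-coprime a⊥1) ⟩
  mkℚ (ℤ.+ a) 0 a⊥1 ℚ.+ mkℚ (ℤ.+ p) n c    ≡⟨ /-cong numerator (*-identityˡ (suc n)) ⟩
  ℤ.+ (a * suc n + p) ℚ./ suc n            ≡⟨ normalize-coprime (Coprimality.sym (coprime-*-+ a c)) ⟩
  mkℚ (ℤ.+ (a * suc n + p)) n _            ∎
  where
  open ≡-Reasoning
  a⊥1 : Coprime a 1
  a⊥1 (_ , d∣1) = ∣1⇒≡1 d∣1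
  numerator : ℤ.+ a ℤ.* ℤ.+ suc n ℤ.+ ℤ.+ p ℤ.* ℤ.+ 1 ≡ ℤ.+ (a * suc n + p)
  numerator = trans (cong₂ ℤ._+_ (sym (ℤ.pos-* a (suc n))) (ℤ.*-identityʳ (ℤ.+ p)))
                    (sym (ℤ.pos-+ (a * suc n) p))

cf-head : ∀ a L → cf a L ≡ (ℤ.+ a ℚ./ 1) ℚ.+ cf 0 L
cf-head a []      = sym (ℚ-+-identityʳ _)
cf-head a (b ∷ L) = cong ((ℤ.+ a ℚ./ 1) ℚ.+_) (sym (ℚ-+-identityˡ _))

cf≡mkℚ+ : ∀ {L} (pos : All (1 ≤_) L) →
          cf 0 L ≡ mkℚ+ (cfNum L) (cfDen L) {{cfDen-nonZero pos}} (cfNum-cfDen-coprime L)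
cf≡mkℚ+ []                   = refl
cf≡mkℚ+ {a ∷ L} (1≤a ∷ pos) = begin
  0ℚ ℚ.+ inv (cf a L)                      ≡⟨ ℚ-+-identityˡ _ ⟩
  inv (cf a L)                             ≡⟨ cong inv (trans (cf-head a L) (cong (a/1 ℚ.+_) (cf≡mkℚ+ pos))) ⟩
  inv (a/1 ℚ.+ mkℚ+ p q p⊥q)               ≡⟨ cong inv (+-mkℚ+ a p q p⊥q) ⟩
  inv (mkℚ+ (a * q + p) q _)               ≡⟨ inv-mkℚ+ (a * q + p) q _ ⟩
  mkℚ+ q (a * q + p) _                     ∎
  where
  open ≡-Reasoning
  a/1 = ℤ.+ a ℚ./ 1
  p = cfNum L
  q = cfDen L
  p⊥q = cfNum-cfDen-coprime L
  instance
    q≢0 : NonZero q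
    q≢0 = cfDen-nonZero pos
    aq+p≢0 : NonZero (a * q + p)
    aq+p≢0 = cfDen-nonZero (1≤a ∷ pos)

den-cf : ∀ {L} → All (1 ≤_) L → den (cf 0 L) ≡ cfDen L
den-cf {L} pos = trans (cong den (cf≡mkℚ+ pos)) (den-mkℚ+ (cfNum L) (cfDen L) {{cfDen-nonZero pos}} _)
  where
  den-mkℚ+ : ∀ n d .{{_ : NonZero d}} .(c : Coprime n d) → den (mkℚ+ n d c) ≡ d
  den-mkℚ+ n (suc d) c = refl

-- Denominators are never squares

-- (v / m) = -1 and m ≡ 3 (mod 4), with the symbol read off through Gauss's lemma
record JacobiMinusOne (m v : ℕ) : Set where
  field
    half           : ℕ
    m≡2h+1         : m ≡ 2* half +1
    m%4≡3          : m % 4 ≡ 3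
    v⊥m            : Coprime v m
    gaussCount-odd : parity (gaussCount v half) ≡ 1ℙ

module _ {m v} (J : JacobiMinusOne m v) where
  open JacobiMinusOne J

  JacobiMinusOne-numerator : ∀ c → JacobiMinusOne m (c * m + v)
  JacobiMinusOne-numerator c = record
    { half           = half
    ; m≡2h+1         = m≡2h+1
    ; m%4≡3          = m%4≡3
    ; v⊥m            = Coprimality.sym (coprime-*-+ c v⊥m)
    ; gaussCount-odd = trans (cong parity (∑-cong half _ _ same-residue)) gaussCount-odd
    }
    where
    n = 2* half +1
    expand : ∀ c n v i → (c * n + v) * i ≡ v * i + (c * i) * n
    expand = solve-∀
    same-residue : ∀ i → 1 ≤ i → i ≤ half → gaussNeg (c * m + v) half i ≡ gaussNeg v half i
    same-residue i _ _ = cong (λ r → 𝟙[ half <? r ]) (begin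
      ((c * m + v) * i) % n     ≡⟨ cong (λ x → ((c * x + v) * i) % n) m≡2h+1 ⟩
      ((c * n + v) * i) % n     ≡⟨ cong (_% n) (expand c n v i) ⟩
      (v * i + (c * i) * n) % n ≡⟨ [m+kn]%n≡m%n (v * i) (c * i) n ⟩
      (v * i) % n               ∎)
      where open ≡-Reasoning

  JacobiMinusOne-modulus : ∀ a → JacobiMinusOne (4 * a * v + m) v
  JacobiMinusOne-modulus a = record
    { half           = half + a * (v + v)
    ; m≡2h+1         = trans (cong (4 * a * v +_) m≡2h+1) (expand a v half)
    ; m%4≡3          = trans (cong (_% 4) (reorder a v m)) (trans ([m+kn]%n≡m%n m (a * v) 4) m%4≡3)
    ; v⊥m            = coprime-*-+ (4 * a) (Coprimality.sym v⊥m)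
    ; gaussCount-odd = trans (gaussCount-periodic-* a v half) gaussCount-odd
    }
    where
    expand : ∀ a v h → 4 * a * v + suc (h + h) ≡ suc (h + a * (v + v) + (h + a * (v + v)))
    expand = solve-∀
    reorder : ∀ a v m → 4 * a * v + m ≡ m + a * v * 4
    reorder = solve-∀

JacobiMinusOne-nonSquare : ∀ {m k} → ¬ JacobiMinusOne m (k * k)
JacobiMinusOne-nonSquare {k = k} J = 0ℙ≢1ℙ (trans (sym (gaussCount-square k half k⊥2h+1)) gaussCount-odd)
  where
  open JacobiMinusOne J
  k⊥2h+1 : Coprime k (2* half +1)
  k⊥2h+1 (d∣k , d∣2h+1) = v⊥m (∣-trans d∣k (m∣m*n k) , subst (_ ∣_) (sym m≡2h+1) d∣2h+1)
  0ℙ≢1ℙ : 0ℙ ≢ 1ℙ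
  0ℙ≢1ℙ ()

square%4≢3 : ∀ k → (k * k) % 4 ≢ 3
square%4≢3 k k²%4≡3 = residue-square (k % 4) (m%n<n k 4) (trans (sym (%-distribˡ-* k k 4)) k²%4≡3)
  where
  residue-square : ∀ r → r < 4 → (r * r) % 4 ≢ 3
  residue-square 0 _ ()
  residue-square 1 _ ()
  residue-square 2 _ ()
  residue-square 3 _ ()
  residue-square (suc (suc (suc (suc _)))) (s≤s (s≤s (s≤s (s≤s ()))))

Alternating : List ℕ → Set
Alternating L = JacobiMinusOne (cfNum L) (cfDen L) ⊎ JacobiMinusOne (cfDen L) (cfNum L)

alternating-base : ∀ b → Alternating (b ∷ 1 ∷ 2 ∷ [])
alternating-base b = inj₁ (record
  { half           = 1
  ; m≡2h+1         = refl
  ; m%4≡3          = refl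
  ; v⊥m            = Coprimality.sym (coprime-*-+ b (from-yes (coprime? 2 3)))
  ; gaussCount-odd = cong (λ r → parity (𝟙[ 1 <? r ] + 0)) residue≡2
  })
  where
  residue≡2 : ((b * 3 + 2) * 1) % 3 ≡ 2
  residue≡2 = trans (cong (_% 3) (trans (*-identityʳ _) (+-comm (b * 3) 2))) ([m+kn]%n≡m%n 2 b 3)

alternating-step : ∀ a L → Alternating L → Alternating (4 * a ∷ L)
alternating-step a L (inj₁ J) = inj₂ (JacobiMinusOne-modulus J a)
alternating-step a L (inj₂ J) = inj₁ (JacobiMinusOne-numerator J (4 * a))

alternating : ∀ as b → Alternating (map (4 *_) as ++ b ∷ 1 ∷ 2 ∷ [])
alternating []       b = alternating-base b
alternating (a ∷ as) b = alternating-step a (map (4 *_) as ++ b ∷ 1 ∷ 2 ∷ []) (alternating as b)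

alternating⇒nonSquare : ∀ L → Alternating L → ∀ k → cfDen L ≢ k * k
alternating⇒nonSquare L (inj₁ J) k q≡k² =
  JacobiMinusOne-nonSquare {k = k} (subst (JacobiMinusOne (cfNum L)) q≡k² J)
alternating⇒nonSquare L (inj₂ J) k q≡k² =
  square%4≢3 k (trans (cong (_% 4) (sym q≡k²)) (JacobiMinusOne.m%4≡3 J))

-- Every residue class is reached

-- a ≡ b (mod M), with both sides moved so that no subtraction occurs
infix 4 _≡_[mod_]
_≡_[mod_] : ℕ → ℕ → ℕ → Set
a ≡ b [mod M ] = ∃₂ λ c d → a + c * M ≡ b + d * M

≡[mod]⇒%≡ : ∀ {a b M} .{{_ : NonZero M}} → a ≡ b [mod M ] → a % M ≡ b % M
≡[mod]⇒%≡ {a} {b} {M} (c , d , eq) =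
  trans (sym ([m+kn]%n≡m%n a c M)) (trans (cong (_% M) eq) ([m+kn]%n≡m%n b d M))

≡[mod]-+-multiple : ∀ k {a b M} → a ≡ b [mod M ] → a + k * M ≡ b [mod M ]
≡[mod]-+-multiple k {a} {b} {M} (c , d , eq) = c , d + k , (begin
  a + k * M + c * M     ≡⟨ swap a (k * M) (c * M) ⟩
  a + c * M + k * M     ≡⟨ cong (_+ k * M) eq ⟩
  b + d * M + k * M     ≡⟨ +-assoc b (d * M) (k * M) ⟩
  b + (d * M + k * M)   ≡⟨ cong (b +_) (*-distribʳ-+ M d k) ⟨
  b + (d + k) * M       ∎)
  where
  open ≡-Reasoning
  swap : ∀ x y z → x + y + z ≡ x + z + y
  swap = solve-∀

even⊎odd : ∀ n → ∃ λ g → n ≡ g + g ⊎ n ≡ suc (g + g)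
even⊎odd zero = 0 , inj₁ refl
even⊎odd (suc n) with even⊎odd n
... | g , inj₁ refl = g , inj₂ refl
... | g , inj₂ refl = suc g , inj₁ (cong suc (sym (+-suc g g)))

≡[mod]-double : ∀ {a b M} → a ≡ b [mod M ] → a ≡ b [mod M + M ] ⊎ a + M ≡ b [mod M + M ]
≡[mod]-double {a} {b} {M} (c , d , eq) = halve (even⊎odd (c + d))
  where
  open ≡-Reasoning
  a+2cM≡ : a + c * (M + M) ≡ b + (c + d) * M
  a+2cM≡ = begin
    a + c * (M + M)       ≡⟨ split a c M ⟩
    a + c * M + c * M     ≡⟨ cong (_+ c * M) eq ⟩
    b + d * M + c * M     ≡⟨ merge b c d M ⟩
    b + (c + d) * M       ∎
    where
    split : ∀ a c M → a + c * (M + M) ≡ a + c * M + c * M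
    split = solve-∀
    merge : ∀ b c d M → b + d * M + c * M ≡ b + (c + d) * M
    merge = solve-∀
  halve : (∃ λ g → c + d ≡ g + g ⊎ c + d ≡ suc (g + g)) →
          a ≡ b [mod M + M ] ⊎ a + M ≡ b [mod M + M ]
  halve (g , inj₁ c+d≡2g) = inj₁ (c , g , (begin
    a + c * (M + M)       ≡⟨ a+2cM≡ ⟩
    b + (c + d) * M       ≡⟨ cong (λ n → b + n * M) c+d≡2g ⟩
    b + (g + g) * M       ≡⟨ regroup b g M ⟩
    b + g * (M + M)       ∎))
    where
    regroup : ∀ b g M → b + (g + g) * M ≡ b + g * (M + M)
    regroup = solve-∀
  halve (g , inj₂ c+d≡2g+1) = inj₂ (c , suc g , (begin
    a + M + c * (M + M)       ≡⟨ +-comm-middle a M (c * (M + M)) ⟩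
    a + c * (M + M) + M       ≡⟨ cong (_+ M) a+2cM≡ ⟩
    b + (c + d) * M + M       ≡⟨ cong (λ n → b + n * M + M) c+d≡2g+1 ⟩
    b + suc (g + g) * M + M   ≡⟨ regroup b g M ⟩
    b + suc g * (M + M)       ∎))
    where
    +-comm-middle : ∀ x y z → x + y + z ≡ x + z + y
    +-comm-middle = solve-∀
    regroup : ∀ b g M → b + suc (g + g) * M + M ≡ b + suc g * (M + M)
    regroup = solve-∀

familyDen : ℕ → ℕ → ℕ
familyDen u b = cfDen (4 * u ∷ 4 ∷ b ∷ 1 ∷ 2 ∷ [])

Realizes : ℕ → ℕ → Set
Realizes M T = ∃₂ λ u b → 1 ≤ u × 1 ≤ b × familyDen u b ≡ T [mod M ]

-- Modulo M = 2m + 1, b = 2M - 1 ≡ -1 makes familyDen u b ≡ -4u - 1, and (2m + 2)² ≡ 1,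
-- so u ≡ -(T + 1)(m + 1)² works.
familyDen-odd : ∀ m T → Realizes (suc (m + m)) T
familyDen-odd m T = u , suc (4 * m) , s≤s z≤n , s≤s z≤n ,
                    suc T * (4 * (m * m) + 6 * m + 1) + 4 , 6 * (16 * u + 1) , identity m T
  where
  u = suc (m + m + (m + m) * (suc T * (suc m * suc m)))
  identity : ∀ m T → let u = suc (m + m + (m + m) * (suc T * (suc m * suc m))) in
    4 * u * (4 * (suc (4 * m) * 3 + 2) + 3) + (suc (4 * m) * 3 + 2)
      + (suc T * (4 * (m * m) + 6 * m + 1) + 4) * suc (m + m)
    ≡ T + 6 * (16 * u + 1) * suc (m + m)
  identity = solve-∀

familyDen-shift : ∀ u b M → familyDen u (b + M) ≡ familyDen u b + M + (24 * u + 1) * (M + M)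
familyDen-shift = expanded
  where
  expanded : ∀ u b M → 4 * u * (4 * ((b + M) * 3 + 2) + 3) + ((b + M) * 3 + 2)
                       ≡ 4 * u * (4 * (b * 3 + 2) + 3) + (b * 3 + 2) + M + (24 * u + 1) * (M + M)
  expanded = solve-∀

familyDen-double : ∀ M T → Realizes M T → Realizes (M + M) T
familyDen-double M T (u , b , 1≤u , 1≤b , F≡T) with ≡[mod]-double F≡T
... | inj₁ F≡T[2M]   = u , b , 1≤u , 1≤b , F≡T[2M]
... | inj₂ F+M≡T[2M] = u , b + M , 1≤u , ≤-trans 1≤b (m≤m+n b M) ,
  subst (_≡ T [mod M + M ]) (sym (familyDen-shift u b M)) (≡[mod]-+-multiple (24 * u + 1) F+M≡T[2M])

familyDen-realizes : ∀ M → 1 ≤ M → ∀ T → Realizes M T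
familyDen-realizes = <-rec (λ M → 1 ≤ M → ∀ T → Realizes M T) realize
  where
  realize : ∀ M → (∀ {M′} → M′ < M → 1 ≤ M′ → ∀ T → Realizes M′ T) →
            1 ≤ M → ∀ T → Realizes M T
  realize M rec 1≤M T with even⊎odd M
  ... | zero , inj₁ refl   = contradiction 1≤M λ ()
  ... | m , inj₂ refl       = familyDen-odd m T
  ... | suc M′ , inj₁ refl = familyDen-double (suc M′) T (rec (m<m+n (suc M′) (s≤s z≤n)) (s≤s z≤n) T)

tailS-positive : ∀ n (a : Fin n → ℕ) b → (∀ i → 1 ≤ a i) → 1 ≤ b → All (1 ≤_) (tailS n a b)
tailS-positive zero    a b _   1≤b = 1≤b ∷ s≤s z≤n ∷ s≤s z≤n ∷ []
tailS-positive (suc n) a b 1≤a 1≤b =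
  *-mono-≤ {1} {4} (s≤s z≤n) (1≤a zero) ∷ tailS-positive n (a ∘ suc) b (1≤a ∘ suc) 1≤b

corollary2p20 :
    ((m : ℕ) .{{_ : NonZero m}} (r : ℕ) →
      Σ ℚ λ q → InS q × (den q % m ≡ r % m))
    × ((q : ℚ) → InS q → (k : ℕ) → den q ≢ k * k)
corollary2p20 = admissible , nonSquare
  where
  admissible : (m : ℕ) .{{_ : NonZero m}} (r : ℕ) → Σ ℚ λ q → InS q × (den q % m ≡ r % m)
  admissible m r with familyDen-realizes m (>-nonZero⁻¹ m) r
  ... | u , b , 1≤u , 1≤b , F≡r =
    cf 0 (tailS 2 a b) , (2 , a , b , 1≤a , 1≤b , refl) ,
    trans (cong (_% m) (den-cf (tailS-positive 2 a b 1≤a 1≤b))) (≡[mod]⇒%≡ F≡r)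
    where
    a : Fin 2 → ℕ
    a zero       = u
    a (suc zero) = 1
    1≤a : ∀ i → 1 ≤ a i
    1≤a zero       = 1≤u
    1≤a (suc zero) = s≤s z≤n

  nonSquare : (q : ℚ) → InS q → (k : ℕ) → den q ≢ k * k
  nonSquare q (n , a , b , 1≤a , 1≤b , refl) k =
    alternating⇒nonSquare (tailS n a b) (alternating (toList a) b) k
      ∘ trans (sym (den-cf (tailS-positive n a b 1≤a 1≤b)))
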